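{- For every positive integer $n$, every maximal matching of the permutahedron $\mathrm{P}_n$ has at least $\dfrac{n!\,(n-1)}{3n-2}$ edges.
   Context: The permutahedron $\mathrm{P}_n$ is the graph whose vertices are the permutations of $[n]$ in one-line notation, two permutations being adjacent if one is obtained from the other by swapping the entries at two consecutive positions. A maximal matching is a set of pairwise vertex-disjoint edges that is maximal with respect to inclusion. -}

module Defs where

open import Data.Nat using (ℕ; suc)
open import Data.Fin using (Fin; toℕ)
open import Data.Vec using (Vec; lookup; _[_]≔_)
open import Data.List using (List; length)
open import Data.List.Relation.Unary.All using (All)
open import Data.List.Relation.Unary.Any using (Any)
open import Data.Product using (Σ; _×_; proj₁; proj₂)
open import Data.Sum using (_⊎_)
open import Data.Empty using (⊥)
open import Relation.Binary.PropositionalEquality using (_≡_; _≢_)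
import Data.List as L

-- A permutation of [n] in one-line notation: a vector of length n with
-- entries in Fin n (= {0..n-1}, standing for [n]) that is injective.
IsPerm : {n : ℕ} → Vec (Fin n) n → Set
IsPerm {n} p = (i j : Fin n) → lookup p i ≡ lookup p j → i ≡ j

Adjacent : {n : ℕ} → Vec (Fin n) n → Vec (Fin n) n → Set
Adjacent {n} p q =
  Σ (Fin n) λ i → Σ (Fin n) λ j →
    (toℕ j ≡ suc (toℕ i)) × (q ≡ (p [ i ]≔ lookup p j) [ j ]≔ lookup p i)

Edge : ℕ → Set
Edge n = Vec (Fin n) n × Vec (Fin n) n

IsEdge : {n : ℕ} → Edge n → Set
IsEdge e = IsPerm (proj₁ e) × Adjacent (proj₁ e) (proj₂ e)

_∈ₑ_ : {n : ℕ} → Vec (Fin n) n → Edge n → Set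
v ∈ₑ e = (v ≡ proj₁ e) ⊎ (v ≡ proj₂ e)

VertexDisjoint : {n : ℕ} → Edge n → Edge n → Set
VertexDisjoint {n} e f = (v : Vec (Fin n) n) → v ∈ₑ e → v ∈ₑ f → ⊥

IsMatching : {n : ℕ} → List (Edge n) → Set
IsMatching {n} M =
  All IsEdge M ×
  ((a b : Fin (length M)) → a ≢ b → VertexDisjoint (L.lookup M a) (L.lookup M b))

Covered : {n : ℕ} → Vec (Fin n) n → List (Edge n) → Set
Covered v M = Any (λ e → v ∈ₑ e) M

-- Maximal matching: a matching to which no edge of P_n can be added, i.e.
-- every edge of P_n has an endpoint covered by M.
IsMaximalMatching : {n : ℕ} → List (Edge n) → Set
IsMaximalMatching {n} M =
  IsMatching M ×
  ((p q : Vec (Fin n) n) → IsPerm p → Adjacent p q → Covered p M ⊎ Covered q M)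

-- Double counting.  Each of the (n+1)!·n pairs (p, j) of a permutation p of [n+1] and a
-- position j < n (the edge from p to p·s_j) is charged injectively to an edge {u, v = u·s_a}
-- of M and one of its 3n+1 = 3(n+1) - 2 slots.  If p is u or v, the slot is j in the block of
-- u or of v.  Otherwise p·s_j is covered, by maximality; when p·s_j = u the slot is j+1 (then
-- j ≠ a), and when p·s_j = v it is a+1 for j = a+1, 0 for j = a-1, and j+1 for j far from a.
-- The last choice cannot collide with the case p·s_j = u, as u·s_j and v·s_j = u·s_j·s_a
-- would be adjacent and both uncovered.

module Submission where

open import Data.Empty using (⊥; ⊥-elim)
open import Data.Fin as Fin using (Fin; zero; suc; toℕ; inject₁; fromℕ<; remQuot)
open import Data.Fin.Permutation using (Permutation′; _⟨$⟩ʳ_; _≈_; id; lift₀; transpose; _∘ₚ_)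
open import Data.Fin.Properties
  using (suc-injective; toℕ-injective; toℕ-inject₁; inject₁-injective; toℕ<n; toℕ-fromℕ<;
         injective⇒≤; *↔×; +↔⊎)
open import Data.List using (List; length)
import Data.List as List
open import Data.List.Membership.Propositional using (lose)
open import Data.List.Membership.Propositional.Properties using (∈-lookup)
open import Data.List.Relation.Unary.All as All using (All)
open import Data.List.Relation.Unary.Any using (index; any?)
open import Data.List.Relation.Unary.Any.Properties using (lookup-index)
open import Data.Nat using (ℕ; zero; suc; _+_; _*_; _∸_; _≤_; _<_; _!; s≤s; z≤n)
open import Data.Nat.Properties using (<⇒≢; >⇒≢; <⇒≤; m<n⇒m<1+n; ≤-pred)
import Data.Nat.Properties as ℕ
open import Data.Nat.Tactic.RingSolver using (solve-∀)
open import Data.Product using (Σ; _×_; _,_; proj₁; proj₂; uncurry)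
open import Data.Product.Function.NonDependent.Propositional using (_×-↔_)
open import Data.Sum using (_⊎_; inj₁; inj₂; [_,_]′)
open import Data.Sum.Function.Propositional using (_⊎-↔_)
open import Data.Vec using (Vec; lookup; tabulate; _[_]≔_)
open import Data.Vec.Properties using (≡-dec; lookup∘tabulate; lookup∘update; lookup∘update′)
open import Data.Vec.Relation.Binary.Pointwise.Extensional using (ext; Pointwise-≡⇒≡)
open import Function.Bundles using (Injection; _↣_; _↔_)
open import Function.Construct.Composition using (_↔-∘_)
open import Function.Construct.Identity using (↔-id)
open import Function.Construct.Symmetry using (↔-sym)
open import Function.Properties.Inverse using (↔⇒↣)
open import Relation.Binary.PropositionalEquality
  using (_≡_; _≢_; refl; sym; trans; cong; cong₂; subst; module ≡-Reasoning)
open import Relation.Nullary using (¬_; Dec; yes; no)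
open import Relation.Nullary.Decidable using (_⊎-dec_)

open import Defs

permutation-injective : {n : ℕ} (π : Permutation′ n) {i j : Fin n} → π ⟨$⟩ʳ i ≡ π ⟨$⟩ʳ j → i ≡ j
permutation-injective π = Injection.injective (↔⇒↣ π)

-- _∘ₚ_ composes left to right, so insertFirst k π sends 0 to k.
insertFirst : {n : ℕ} → Fin (suc n) → Permutation′ n → Permutation′ (suc n)
insertFirst k π = lift₀ π ∘ₚ transpose zero k

insertFirst-injective : {n : ℕ} {k k′ : Fin (suc n)} {π ρ : Permutation′ n} →
  insertFirst k π ≈ insertFirst k′ ρ → k ≡ k′ × π ≈ ρ
insertFirst-injective {k = k} {k′} {π} {ρ} eq = k≡k′ , π≈ρ
  where
  k≡k′ : k ≡ k′
  k≡k′ = eq zero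
  π≈ρ : π ≈ ρ
  π≈ρ i = suc-injective (permutation-injective (transpose zero k)
    (trans (eq (suc i)) (cong (λ l → transpose zero l ⟨$⟩ʳ suc (ρ ⟨$⟩ʳ i)) (sym k≡k′))))

enumerate : (n : ℕ) → Fin (n !) → Permutation′ n
enumerate zero    _ = id
enumerate (suc n) x = let (k , y) = remQuot (n !) x in insertFirst k (enumerate n y)

enumerate-injective : (n : ℕ) {x y : Fin (n !)} → enumerate n x ≈ enumerate n y → x ≡ y
enumerate-injective zero {zero} {zero} _ = refl
enumerate-injective (suc n) eq =
  let (k≡k′ , π≈ρ) = insertFirst-injective eq
  in Injection.injective (↔⇒↣ *↔×) (cong₂ _,_ k≡k′ (enumerate-injective n π≈ρ))

toVec : {n : ℕ} → Permutation′ n → Vec (Fin n) n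
toVec π = tabulate (π ⟨$⟩ʳ_)

toVec-isPerm : {n : ℕ} (π : Permutation′ n) → IsPerm (toVec π)
toVec-isPerm π i j eq = permutation-injective π (begin
  π ⟨$⟩ʳ i            ≡⟨ lookup∘tabulate (π ⟨$⟩ʳ_) i ⟨
  lookup (toVec π) i  ≡⟨ eq ⟩
  lookup (toVec π) j  ≡⟨ lookup∘tabulate (π ⟨$⟩ʳ_) j ⟩
  π ⟨$⟩ʳ j            ∎)
  where open ≡-Reasoning

toVec-injective : {n : ℕ} {π ρ : Permutation′ n} → toVec π ≡ toVec ρ → π ≈ ρ
toVec-injective {π = π} {ρ} eq i = begin
  π ⟨$⟩ʳ i            ≡⟨ lookup∘tabulate (π ⟨$⟩ʳ_) i ⟨
  lookup (toVec π) i  ≡⟨ cong (λ v → lookup v i) eq ⟩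
  lookup (toVec ρ) i  ≡⟨ lookup∘tabulate (ρ ⟨$⟩ʳ_) i ⟩
  ρ ⟨$⟩ʳ i            ∎
  where open ≡-Reasoning

inject₁≢suc : {n : ℕ} (a : Fin n) → inject₁ a ≢ suc a
inject₁≢suc zero    ()
inject₁≢suc (suc a) eq = inject₁≢suc a (suc-injective eq)

module _ {A : Set} {n : ℕ} where

  swap : Vec A (suc n) → Fin n → Vec A (suc n)
  swap p a = (p [ inject₁ a ]≔ lookup p (suc a)) [ suc a ]≔ lookup p (inject₁ a)

  lookup-swap-inject₁ : (p : Vec A (suc n)) (a : Fin n) → lookup (swap p a) (inject₁ a) ≡ lookup p (suc a)
  lookup-swap-inject₁ p a =
    trans (lookup∘update′ (inject₁≢suc a) (p [ inject₁ a ]≔ lookup p (suc a)) (lookup p (inject₁ a)))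
          (lookup∘update (inject₁ a) p (lookup p (suc a)))

  lookup-swap-suc : (p : Vec A (suc n)) (a : Fin n) → lookup (swap p a) (suc a) ≡ lookup p (inject₁ a)
  lookup-swap-suc p a = lookup∘update (suc a) (p [ inject₁ a ]≔ lookup p (suc a)) (lookup p (inject₁ a))

  lookup-swap-other : (p : Vec A (suc n)) (a : Fin n) {k : Fin (suc n)} → k ≢ inject₁ a → k ≢ suc a →
    lookup (swap p a) k ≡ lookup p k
  lookup-swap-other p a k≢i k≢s =
    trans (lookup∘update′ k≢s (p [ inject₁ a ]≔ lookup p (suc a)) (lookup p (inject₁ a)))
          (lookup∘update′ k≢i p (lookup p (suc a)))

  swap-involutive : (p : Vec A (suc n)) (a : Fin n) → swap (swap p a) a ≡ p
  swap-involutive p a = Pointwise-≡⇒≡ (ext agree)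
    where
    agree : (k : Fin (suc n)) → lookup (swap (swap p a) a) k ≡ lookup p k
    agree k with k Fin.≟ inject₁ a | k Fin.≟ suc a
    ... | yes refl | _        = trans (lookup-swap-inject₁ (swap p a) a) (lookup-swap-suc p a)
    ... | no _     | yes refl = trans (lookup-swap-suc (swap p a) a) (lookup-swap-inject₁ p a)
    ... | no k≢i   | no k≢s   =
      trans (lookup-swap-other (swap p a) a k≢i k≢s) (lookup-swap-other p a k≢i k≢s)

  swap-invert : {p q : Vec A (suc n)} (a : Fin n) → swap p a ≡ q → p ≡ swap q a
  swap-invert {p} a eq = trans (sym (swap-involutive p a)) (cong (λ r → swap r a) eq)

  swap-injective : {p q : Vec A (suc n)} (a : Fin n) → swap p a ≡ swap q a → p ≡ q
  swap-injective {q = q} a eq = trans (swap-invert a eq) (swap-involutive q a)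

Far : ℕ → ℕ → Set
Far i j = 2 + i ≤ j ⊎ 2 + j ≤ i

Far-sym : {i j : ℕ} → Far i j → Far j i
Far-sym (inj₁ 2+i≤j) = inj₂ 2+i≤j
Far-sym (inj₂ 2+j≤i) = inj₁ 2+j≤i

Far⇒≢ : {i j : ℕ} → Far i j → i ≢ j
Far⇒≢ (inj₁ 2+i≤j) = <⇒≢ (<⇒≤ 2+i≤j)
Far⇒≢ (inj₂ 2+j≤i) = >⇒≢ (<⇒≤ 2+j≤i)

Far⇒suc≢ : {i j : ℕ} → Far i j → suc i ≢ j
Far⇒suc≢ (inj₁ 2+i≤j) = <⇒≢ 2+i≤j
Far⇒suc≢ (inj₂ 2+j≤i) = >⇒≢ (m<n⇒m<1+n (<⇒≤ 2+j≤i))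

data Relative (i j : ℕ) : Set where
  equal : j ≡ i → Relative i j
  above : j ≡ suc i → Relative i j
  below : suc j ≡ i → Relative i j
  apart : Far i j → Relative i j

relative : (i j : ℕ) → Relative i j
relative zero          zero          = equal refl
relative zero          (suc zero)    = above refl
relative zero          (suc (suc j)) = apart (inj₁ (s≤s (s≤s z≤n)))
relative (suc zero)    zero          = below refl
relative (suc (suc i)) zero          = apart (inj₂ (s≤s (s≤s z≤n)))
relative (suc i)       (suc j) with relative i j
... | equal j≡i          = equal (cong suc j≡i)
... | above j≡1+i        = above (cong suc j≡1+i)
... | below 1+j≡i        = below (cong suc 1+j≡i)
... | apart (inj₁ 2+i≤j) = apart (inj₁ (s≤s 2+i≤j))
... | apart (inj₂ 2+j≤i) = apart (inj₂ (s≤s 2+j≤i))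

module _ {n : ℕ} {a b : Fin n} (far : Far (toℕ a) (toℕ b)) where

  private
    inject₁≢inject₁ : inject₁ a ≢ inject₁ b
    inject₁≢inject₁ eq = Far⇒≢ far (cong toℕ (inject₁-injective eq))

    suc≢suc : suc a ≢ suc b
    suc≢suc eq = Far⇒≢ far (cong toℕ (suc-injective eq))

    suc≢inject₁ : suc a ≢ inject₁ b
    suc≢inject₁ eq = Far⇒suc≢ far (trans (cong toℕ eq) (toℕ-inject₁ b))

    inject₁≢suc′ : inject₁ a ≢ suc b
    inject₁≢suc′ eq = Far⇒suc≢ (Far-sym far) (trans (sym (cong toℕ eq)) (toℕ-inject₁ a))

  lookup-swap-comm-inject₁ : {A : Set} (p : Vec A (suc n)) →
    lookup (swap (swap p a) b) (inject₁ a) ≡ lookup (swap (swap p b) a) (inject₁ a)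
  lookup-swap-comm-inject₁ p = begin
    lookup (swap (swap p a) b) (inject₁ a)  ≡⟨ lookup-swap-other (swap p a) b inject₁≢inject₁ inject₁≢suc′ ⟩
    lookup (swap p a) (inject₁ a)           ≡⟨ lookup-swap-inject₁ p a ⟩
    lookup p (suc a)                        ≡⟨ lookup-swap-other p b suc≢inject₁ suc≢suc ⟨
    lookup (swap p b) (suc a)               ≡⟨ lookup-swap-inject₁ (swap p b) a ⟨
    lookup (swap (swap p b) a) (inject₁ a)  ∎
    where open ≡-Reasoning

  lookup-swap-comm-suc : {A : Set} (p : Vec A (suc n)) →
    lookup (swap (swap p a) b) (suc a) ≡ lookup (swap (swap p b) a) (suc a)
  lookup-swap-comm-suc p = begin
    lookup (swap (swap p a) b) (suc a)  ≡⟨ lookup-swap-other (swap p a) b suc≢inject₁ suc≢suc ⟩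
    lookup (swap p a) (suc a)           ≡⟨ lookup-swap-suc p a ⟩
    lookup p (inject₁ a)                ≡⟨ lookup-swap-other p b inject₁≢inject₁ inject₁≢suc′ ⟨
    lookup (swap p b) (inject₁ a)       ≡⟨ lookup-swap-suc (swap p b) a ⟨
    lookup (swap (swap p b) a) (suc a)  ∎
    where open ≡-Reasoning

swap-comm : {A : Set} {n : ℕ} (p : Vec A (suc n)) {a b : Fin n} → Far (toℕ a) (toℕ b) →
  swap (swap p a) b ≡ swap (swap p b) a
swap-comm {n = n} p {a} {b} far = Pointwise-≡⇒≡ (ext agree)
  where
  agree : (k : Fin (suc n)) → lookup (swap (swap p a) b) k ≡ lookup (swap (swap p b) a) k
  agree k with k Fin.≟ inject₁ a | k Fin.≟ suc a | k Fin.≟ inject₁ b | k Fin.≟ suc b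
  ... | yes refl | _        | _        | _        = lookup-swap-comm-inject₁ far p
  ... | no _     | yes refl | _        | _        = lookup-swap-comm-suc far p
  ... | no _     | no _     | yes refl | _        = sym (lookup-swap-comm-inject₁ (Far-sym far) p)
  ... | no _     | no _     | no _     | yes refl = sym (lookup-swap-comm-suc (Far-sym far) p)
  ... | no k≢a   | no k≢1+a | no k≢b   | no k≢1+b = begin
    lookup (swap (swap p a) b) k  ≡⟨ lookup-swap-other (swap p a) b k≢b k≢1+b ⟩
    lookup (swap p a) k           ≡⟨ lookup-swap-other p a k≢a k≢1+a ⟩
    lookup p k                    ≡⟨ lookup-swap-other p b k≢b k≢1+b ⟨
    lookup (swap p b) k           ≡⟨ lookup-swap-other (swap p b) a k≢a k≢1+a ⟨
    lookup (swap (swap p b) a) k  ∎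
    where open ≡-Reasoning

consecutive : {n : ℕ} (i j : Fin (suc n)) → toℕ j ≡ suc (toℕ i) →
  Σ (Fin n) λ a → inject₁ a ≡ i × suc a ≡ j
consecutive {n} i j j≡1+i = a , inject₁a≡i , suca≡j
  where
  i<n : toℕ i < n
  i<n = ≤-pred (subst (_< suc n) j≡1+i (toℕ<n j))
  a : Fin n
  a = fromℕ< i<n
  inject₁a≡i : inject₁ a ≡ i
  inject₁a≡i = toℕ-injective (trans (toℕ-inject₁ a) (toℕ-fromℕ< i<n))
  suca≡j : suc a ≡ j
  suca≡j = toℕ-injective (trans (cong suc (toℕ-fromℕ< i<n)) (sym j≡1+i))

adjacent⇒swap : {n : ℕ} {p q : Vec (Fin (suc n)) (suc n)} → Adjacent p q → Σ (Fin n) λ a → q ≡ swap p a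
adjacent⇒swap (i , j , j≡1+i , refl) with consecutive i j j≡1+i
... | a , refl , refl = a , refl

swap-adjacent : {n : ℕ} (p : Vec (Fin (suc n)) (suc n)) (a : Fin n) → Adjacent p (swap p a)
swap-adjacent p a = inject₁ a , suc a , cong suc (sym (toℕ-inject₁ a)) , refl

data NearSlot {n : ℕ} (a j : Fin n) : Fin (suc n) → Set where
  above : toℕ j ≡ suc (toℕ a) → NearSlot a j (suc a)
  below : suc (toℕ j) ≡ toℕ a → NearSlot a j zero
  apart : Far (toℕ a) (toℕ j) → NearSlot a j (suc j)

nearSlot : {n : ℕ} (a j : Fin n) → j ≢ a → Σ (Fin (suc n)) (NearSlot a j)
nearSlot a j j≢a with relative (toℕ a) (toℕ j)
... | equal j≡a   = ⊥-elim (j≢a (toℕ-injective j≡a))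
... | above j≡1+a = suc a , above j≡1+a
... | below 1+j≡a = zero , below 1+j≡a
... | apart far   = suc j , apart far

nearSlot-injective : {n : ℕ} {a j j′ : Fin n} {x : Fin (suc n)} →
  NearSlot a j x → NearSlot a j′ x → j ≡ j′
nearSlot-injective (above j≡1+a) (above j′≡1+a) = toℕ-injective (trans j≡1+a (sym j′≡1+a))
nearSlot-injective (above _)     (apart far)    = ⊥-elim (Far⇒≢ far refl)
nearSlot-injective (below 1+j≡a) (below 1+j′≡a) =
  toℕ-injective (ℕ.suc-injective (trans 1+j≡a (sym 1+j′≡a)))
nearSlot-injective (apart far)   (above _)      = ⊥-elim (Far⇒≢ far refl)
nearSlot-injective (apart _)     (apart _)      = refl

injectiveRelation⇒≤ : {A B : Set} {a b : ℕ} → Fin a ↣ A → B ↣ Fin b → (R : A → B → Set) →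
  ((x : A) → Σ B (R x)) → (∀ {x x′ y} → R x y → R x′ y → x ≡ x′) → a ≤ b
injectiveRelation⇒≤ {A} {B} {a} {b} fromFin toFin R total functional = injective⇒≤ {f = f} f-injective
  where
  image : Fin a → B
  image i = proj₁ (total (Injection.to fromFin i))
  f : Fin a → Fin b
  f i = Injection.to toFin (image i)
  f-injective : {i j : Fin a} → f i ≡ f j → i ≡ j
  f-injective fi≡fj = Injection.injective fromFin (functional (proj₂ (total _))
    (subst (R _) (sym (Injection.injective toFin fi≡fj)) (proj₂ (total _))))

module EdgeDominatingSet {n : ℕ} (M : List (Edge (suc n))) (edges : All IsEdge M)
  (dominating : (p q : Vec (Fin (suc n)) (suc n)) → IsPerm p → Adjacent p q → Covered p M ⊎ Covered q M)
  where

  Vertex : Set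
  Vertex = Vec (Fin (suc n)) (suc n)

  m : ℕ
  m = length M

  first second : Fin m → Vertex
  first  k = proj₁ (List.lookup M k)
  second k = proj₂ (List.lookup M k)

  position : Fin m → Fin n
  position k = proj₁ (adjacent⇒swap (proj₂ (All.lookup edges (∈-lookup k))))

  second≡swap-first : (k : Fin m) → second k ≡ swap (first k) (position k)
  second≡swap-first k = proj₂ (adjacent⇒swap (proj₂ (All.lookup edges (∈-lookup k))))

  first-covered : (k : Fin m) → Covered (first k) M
  first-covered k = lose (∈-lookup k) (inj₁ refl)

  second-covered : (k : Fin m) → Covered (second k) M
  second-covered k = lose (∈-lookup k) (inj₂ refl)

  Slot : Set
  Slot = Fin n ⊎ Fin n ⊎ Fin (suc n)

  data Charge (p : Vertex) (j : Fin n) : Fin m → Slot → Set where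
    atFirst   : {k : Fin m} → p ≡ first k → Charge p j k (inj₁ j)
    atSecond  : {k : Fin m} → p ≡ second k → Charge p j k (inj₂ (inj₁ j))
    viaFirst  : {k : Fin m} → ¬ Covered p M → swap p j ≡ first k → Charge p j k (inj₂ (inj₂ (suc j)))
    viaSecond : {k : Fin m} {x : Fin (suc n)} → ¬ Covered p M → swap p j ≡ second k →
                NearSlot (position k) j x → Charge p j k (inj₂ (inj₂ x))

  covered? : (p : Vertex) → Dec (Covered p M)
  covered? p = any? (λ e → ≡-dec Fin._≟_ p (proj₁ e) ⊎-dec ≡-dec Fin._≟_ p (proj₂ e)) M

  chargeCovered : {p : Vertex} (j : Fin n) → Covered p M → Σ (Fin m × Slot) (uncurry (Charge p j))
  chargeCovered j c with lookup-index c
  ... | inj₁ p≡first  = (index c , inj₁ j) , atFirst p≡first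
  ... | inj₂ p≡second = (index c , inj₂ (inj₁ j)) , atSecond p≡second

  chargeUncovered : {p : Vertex} (j : Fin n) → ¬ Covered p M → Covered (swap p j) M →
    Σ (Fin m × Slot) (uncurry (Charge p j))
  chargeUncovered {p} j p-uncovered c with lookup-index c
  ... | inj₁ q≡first  = (index c , inj₂ (inj₂ (suc j))) , viaFirst p-uncovered q≡first
  ... | inj₂ q≡second =
    let (x , slot) = nearSlot (position k) j j≢position
    in (k , inj₂ (inj₂ x)) , viaSecond p-uncovered q≡second slot
    where
    k : Fin m
    k = index c
    j≢position : j ≢ position k
    j≢position j≡a = p-uncovered (subst (λ r → Covered r M) (sym p≡first) (first-covered k))
      where
      p≡first : p ≡ first k
      p≡first = swap-injective (position k)
        (trans (cong (swap p) (sym j≡a)) (trans q≡second (second≡swap-first k)))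

  charge : {p : Vertex} → IsPerm p → (j : Fin n) → Σ (Fin m × Slot) (uncurry (Charge p j))
  charge {p} p-perm j with covered? p
  ... | yes c = chargeCovered j c
  ... | no p-uncovered with dominating p (swap p j) p-perm (swap-adjacent p j)
  ...   | inj₁ c = ⊥-elim (p-uncovered c)
  ...   | inj₂ c = chargeUncovered j p-uncovered c

  viaFirst-viaSecond-absurd : {p p′ : Vertex} {j j′ : Fin n} {k : Fin m} → IsPerm p →
    ¬ Covered p M → ¬ Covered p′ M → swap p j ≡ first k → swap p′ j′ ≡ second k →
    NearSlot (position k) j′ (suc j) → ⊥
  viaFirst-viaSecond-absurd {p} {k = k} _ p-uncovered _ q≡first _ (above _) =
    p-uncovered (subst (λ r → Covered r M) (sym p≡second) (second-covered k))
    where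
    p≡second : p ≡ second k
    p≡second = trans (swap-invert (position k) q≡first) (sym (second≡swap-first k))
  viaFirst-viaSecond-absurd {p} {p′} {j} {k = k} p-perm p-uncovered p′-uncovered q≡first q′≡second
    (apart far) = [ p-uncovered , p′-uncovered ]′
      (dominating p p′ p-perm (subst (Adjacent p) (sym p′≡swap-p) (swap-adjacent p a)))
    where
    a : Fin n
    a = position k
    p′≡swap-p : p′ ≡ swap p a
    p′≡swap-p = begin
      p′                         ≡⟨ swap-invert j q′≡second ⟩
      swap (second k) j          ≡⟨ cong (λ r → swap r j) (second≡swap-first k) ⟩
      swap (swap (first k) a) j  ≡⟨ swap-comm (first k) far ⟩
      swap (swap (first k) j) a  ≡⟨ cong (λ r → swap r a) (swap-invert j q≡first) ⟨
      swap p a                   ∎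
      where open ≡-Reasoning

  charge-injective : {p p′ : Vertex} {j j′ : Fin n} {k : Fin m} {s : Slot} → IsPerm p → IsPerm p′ →
    Charge p j k s → Charge p′ j′ k s → p ≡ p′ × j ≡ j′
  charge-injective _ _ (atFirst p≡first) (atFirst p′≡first) = trans p≡first (sym p′≡first) , refl
  charge-injective _ _ (atSecond p≡second) (atSecond p′≡second) = trans p≡second (sym p′≡second) , refl
  charge-injective _ _ (viaFirst _ q≡first) (viaFirst _ q′≡first) =
    swap-injective _ (trans q≡first (sym q′≡first)) , refl
  charge-injective _ _ (viaSecond _ q≡second slot) (viaSecond _ q′≡second slot′)
    with nearSlot-injective slot slot′
  ... | refl = swap-injective _ (trans q≡second (sym q′≡second)) , refl
  charge-injective p-perm _ (viaFirst p-uncovered q≡first) (viaSecond p′-uncovered q′≡second slot) =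
    ⊥-elim (viaFirst-viaSecond-absurd p-perm p-uncovered p′-uncovered q≡first q′≡second slot)
  charge-injective _ p′-perm (viaSecond p-uncovered q≡second slot) (viaFirst p′-uncovered q′≡first) =
    ⊥-elim (viaFirst-viaSecond-absurd p′-perm p′-uncovered p-uncovered q′≡first q≡second slot)

  vertex : Fin (suc n !) → Vertex
  vertex x = toVec (enumerate (suc n) x)

  vertex-isPerm : (x : Fin (suc n !)) → IsPerm (vertex x)
  vertex-isPerm x = toVec-isPerm (enumerate (suc n) x)

  vertex-injective : {x x′ : Fin (suc n !)} → vertex x ≡ vertex x′ → x ≡ x′
  vertex-injective {x} {x′} eq =
    enumerate-injective (suc n) (toVec-injective {π = enumerate (suc n) x} {enumerate (suc n) x′} eq)

  Fin↔Slot : Fin (n + (n + suc n)) ↔ Slot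
  Fin↔Slot = (↔-id (Fin n) ⊎-↔ +↔⊎) ↔-∘ +↔⊎

  Fin↔EdgeSlot : Fin (m * (n + (n + suc n))) ↔ (Fin m × Slot)
  Fin↔EdgeSlot = (↔-id (Fin m) ×-↔ Fin↔Slot) ↔-∘ *↔×

  halfEdges≤slots : suc n ! * n ≤ m * (n + (n + suc n))
  halfEdges≤slots = injectiveRelation⇒≤ (↔⇒↣ *↔×) (↔⇒↣ (↔-sym Fin↔EdgeSlot)) ChargeOf total functional
    where
    ChargeOf : Fin (suc n !) × Fin n → Fin m × Slot → Set
    ChargeOf (x , j) (k , s) = Charge (vertex x) j k s
    total : (xj : Fin (suc n !) × Fin n) → Σ (Fin m × Slot) (ChargeOf xj)
    total (x , j) = charge (vertex-isPerm x) j
    functional : {xj xj′ : Fin (suc n !) × Fin n} {ks : Fin m × Slot} →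
      ChargeOf xj ks → ChargeOf xj′ ks → xj ≡ xj′
    functional {x , _} {x′ , _} c c′ =
      let (p≡p′ , j≡j′) = charge-injective (vertex-isPerm x) (vertex-isPerm x′) c c′
      in cong₂ _,_ (vertex-injective p≡p′) j≡j′

3*[1+n]∸2≡n+[n+[1+n]] : (n : ℕ) → 3 * suc n ∸ 2 ≡ n + (n + suc n)
3*[1+n]∸2≡n+[n+[1+n]] n = cong (_∸ 2) (3*[1+n]≡2+[n+[n+[1+n]]] n)
  where
  3*[1+n]≡2+[n+[n+[1+n]]] : (n : ℕ) → 3 * suc n ≡ 2 + (n + (n + suc n))
  3*[1+n]≡2+[n+[n+[1+n]]] = solve-∀

corollary3p4 : (n : ℕ) → 1 ≤ n → (M : List (Edge n)) → IsMaximalMatching M →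
    (n ! * (n ∸ 1)) ≤ length M * (3 * n ∸ 2)
corollary3p4 (suc n) _ M ((edges , _) , dominating) =
  subst (λ b → suc n ! * n ≤ length M * b) (sym (3*[1+n]∸2≡n+[n+[1+n]] n)) halfEdges≤slots
  where open EdgeDominatingSet M edges dominating
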